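{- Let $\Phi$ be a crystallographic root system with Coxeter diagram $G$, let $(x, L_x, R_x)$ be elastic data for $G$, and let $\alpha \in \Phi$. Then for every integer $n \geq 0$, $\mathrm{st}_n(\alpha) \in \mathrm{st}_n(\Phi)$.
   Context: Let $W$ be a Coxeter group with Coxeter diagram $G$ (vertex set $I$, Coxeter exponents $m_{ij}$). A crystallographic Cartan matrix is an integer matrix $A=(A_{ij})_{i,j\in I}$ with $A_{ii}=2$, $A_{ij}\le 0$ for $i\ne j$, $A_{ij}=0$ iff $m_{ij}=2$, $A_{ij}A_{ji}=4\cos^2(\pi/m_{ij})$ if $3\le m_{ij}<\infty$, and $A_{ij}A_{ji}\ge 4$ if $m_{ij}=\infty$. Let $V$ be a real vector space with basis $\{\alpha_i\}_{i\in I}$ (simple roots), bilinear form $(\alpha_i,\alpha_j)=A_{ij}$, and $W$ acting by $s_i(\beta)=\beta-(\alpha_i,\beta)\alpha_i$. The root system $\Phi$ is the union of the $W$-orbits of the simple roots. Roots are identified with integer-valued functions on the vertices of the diagram (their coefficients in the simple roots). Elastic data for $G$: a vertex $x$ and a partition $L_x\sqcup R_x$ of its neighbors. The diagram $\mathrm{st}_n(G)$ is obtained by replacing $x$ with vertices $x_0,\dots,x_n$, replacing edges from $x$ to $L_x$ by identically labeled edges from $x_0$ to $L_x$, edges from $x$ to $R_x$ by identically labeled edges from $x_n$ to $R_x$, and adding unlabeled edges $x_i - x_{i+1}$ ($0\le i<n$). The Cartan matrix $\mathrm{st}_n(A)$, indexed by vertices of $\mathrm{st}_n(G)$, has entries: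 $A_{yz}$ for $y,z$ off the path $\{x_0,\dots,x_n\}$; $A_{xz}$ at $(x_0,z)$ for $z\in L_x$ and at $(x_n,z)$ for $z\in R_x$; $A_{yx}$ at $(y,x_0)$ for $y\in L_x$ and at $(y,x_n)$ for $y\in R_x$; $2$ at $(x_i,x_i)$; $-1$ at $(x_i,x_{i\pm1})$; $0$ otherwise. $\mathrm{st}_n(\Phi)$ is the root system associated to $\mathrm{st}_n(A)$. For an integer-valued function $\alpha$ on the vertices of $G$, $\mathrm{st}_n(\alpha)$ is the function on the vertices of $\mathrm{st}_n(G)$ taking value $\alpha(x)$ at every $x_i$ and agreeing with $\alpha$ elsewhere. -}

module Defs where

open import Data.Nat as ℕ using (ℕ; zero; suc; _≡ᵇ_)
open import Data.Integer as ℤ using (ℤ; +_; -_; _*_; _-_; _≤_)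
open import Data.Fin using (Fin; zero; suc; toℕ; splitAt; _≟_)
open import Data.Sum using (_⊎_; inj₁; inj₂)
open import Data.Bool using (Bool; true; false; if_then_else_)
open import Data.Maybe using (Maybe; just; nothing)
open import Data.Product using (_×_)
open import Relation.Nullary using (¬_; yes; no)
open import Relation.Binary.PropositionalEquality using (_≡_; _≢_)
open import Function.Bundles using (_⇔_)

-- Coxeter exponents: `just m` is a finite exponent m, `nothing` is ∞.

CoxExp : Set
CoxExp = Maybe ℕ

record IsCoxeterMatrix {k : ℕ} (m : Fin k → Fin k → CoxExp) : Set where
  field
    diag   : ∀ i → m i i ≡ just 1
    sym    : ∀ i j → m i j ≡ m j i
    off≢0  : ∀ i j → i ≢ j → m i j ≢ just 0
    off≢1  : ∀ i j → i ≢ j → m i j ≢ just 1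

-- `FourCos² p v` : the integer v equals 4cos²(π/p) (for p ≥ 3).
-- 4cos²(π/p) is an integer only for p ∈ {3,4,6} (values 1,2,3); for p = 5
-- and p ≥ 7 it is not an integer, so no integer v satisfies it.
data FourCos² : ℕ → ℤ → Set where
  cos3 : FourCos² 3 (+ 1)
  cos4 : FourCos² 4 (+ 2)
  cos6 : FourCos² 6 (+ 3)

record IsCrystallographic {k : ℕ} (m : Fin k → Fin k → CoxExp)
                          (A : Fin k → Fin k → ℤ) : Set where
  field
    diag2    : ∀ i → A i i ≡ + 2
    nonpos   : ∀ i j → i ≢ j → A i j ≤ + 0
    zero⇔2   : ∀ i j → i ≢ j → (A i j ≡ + 0) ⇔ (m i j ≡ just 2)
    finite   : ∀ i j → i ≢ j → ∀ p → m i j ≡ just p → 3 ℕ.≤ p →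
               FourCos² p (A i j * A j i)
    infinite : ∀ i j → i ≢ j → m i j ≡ nothing → + 4 ≤ A i j * A j i

-- Root systems of a Cartan matrix on Fin N; roots are functions Fin N → ℤ
-- (coefficients in the simple roots).

sumℤ : ∀ {N} → (Fin N → ℤ) → ℤ
sumℤ {zero}  f = + 0
sumℤ {suc N} f = f zero ℤ.+ sumℤ (λ i → f (suc i))

δ : ∀ {N} → Fin N → Fin N → ℤ
δ i j with i ≟ j
... | yes _ = + 1
... | no  _ = + 0

-- (α_i , β) where (α_i, α_j) = A i j
pairing : ∀ {N} → (Fin N → Fin N → ℤ) → Fin N → (Fin N → ℤ) → ℤ
pairing A i β = sumℤ (λ j → A i j * β j)

reflect : ∀ {N} → (Fin N → Fin N → ℤ) → Fin N → (Fin N → ℤ) → (Fin N → ℤ)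
reflect A i β j = β j - pairing A i β * δ i j

-- Φ = union of the W-orbits of the simple roots (W generated by the s_i);
-- membership is up to pointwise equality of coefficient functions.
data InΦ {N : ℕ} (A : Fin N → Fin N → ℤ) : (Fin N → ℤ) → Set where
  simple : ∀ i {β} → (∀ j → β j ≡ δ i j) → InΦ A β
  refl-s : ∀ i {γ β} → InΦ A γ → (∀ j → β j ≡ reflect A i γ j) → InΦ A β

-- Elastic data: a vertex x of the diagram and a partition L_x ⊔ R_x of its
-- neighbours, given by `side : Fin k → Bool` (true = L_x, false = R_x);
-- values of `side` at non-neighbours of x are irrelevant.

IsNeighbour : ∀ {k} → (Fin k → Fin k → CoxExp) → Fin k → Fin k → Set
IsNeighbour m x y = x ≢ y × ¬ (m x y ≡ just 2)

-- Vertices of st_n(G) are encoded as Fin (k + n) ≅ Fin k ⊎ Fin n: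
--   inj₁ y (y ≠ x)  ↦ the old vertex y,
--   inj₁ x          ↦ x₀,
--   inj₂ j          ↦ x_{j+1}.

data Loc {k : ℕ} (n : ℕ) : Set where
  off  : Fin k → Loc n          -- an old vertex y ≠ x
  path : Fin (suc n) → Loc n

loc : ∀ {k} n → Fin k → Fin (k ℕ.+ n) → Loc {k} n
loc {k} n x v with splitAt k v
... | inj₂ j = path (suc j)
... | inj₁ y with y ≟ x
...   | yes _ = path zero
...   | no  _ = off y

pathEntry : ℕ → ℕ → ℤ
pathEntry i j =
  if i ≡ᵇ j then + 2
  else if (suc i ≡ᵇ j) Data.Bool.∨ (i ≡ᵇ suc j) then - (+ 1)
  else + 0

-- is the path vertex x_i the endpoint attached to the given side?
-- (L_x is attached at x₀, R_x at x_n)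
attached : (n : ℕ) → Bool → Fin (suc n) → Bool
attached n true  i = toℕ i ≡ᵇ 0
attached n false i = toℕ i ≡ᵇ n

stEntry : ∀ {k} n → (Fin k → Fin k → ℤ) → Fin k → (Fin k → Bool) →
          Loc {k} n → Loc {k} n → ℤ
stEntry n A x side (off y)  (off z)  = A y z
stEntry n A x side (path i) (off z)  =
  if attached n (side z) i then A x z else + 0
stEntry n A x side (off y)  (path i) =
  if attached n (side y) i then A y x else + 0
stEntry n A x side (path i) (path j) = pathEntry (toℕ i) (toℕ j)

stA : ∀ {k} n → (Fin k → Fin k → ℤ) → Fin k → (Fin k → Bool) →
      Fin (k ℕ.+ n) → Fin (k ℕ.+ n) → ℤ
stA n A x side v w = stEntry n A x side (loc n x v) (loc n x w)

stRoot : ∀ {k} n → Fin k → (Fin k → ℤ) → Fin (k ℕ.+ n) → ℤ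
stRoot n x α v with loc n x v
... | off y  = α y
... | path _ = α x

module Submission where

-- Induct on the derivation of α ∈ Φ, lifting each generator of W. For i ≠ x, the simple root α_i
-- and the reflection s_i lift verbatim, because α_i is joined to exactly one endpoint of the path
-- x_0 - ⋯ - x_n. The reflection s_x lifts to the palindrome
-- s_{x_0} ⋯ s_{x_{n-1}} s_{x_n} s_{x_{n-1}} ⋯ s_{x_0}: applied to st_n(γ), the first half replaces γ_x
-- by u = -Σ_{y∈L_x} A_{xy} γ_y on x_0, …, x_{n-1} one vertex at a time, s_{x_n} turns γ_x into
-- γ_x - (α_x, γ) on x_n, and the second half sweeps this value back down to x_0. Similarly
-- st_n(α_x) = s_{x_0} ⋯ s_{x_{n-1}}(α_{x_n}).

open import Defs
open import Data.Nat using (ℕ)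
open import Data.Integer using (ℤ)
open import Data.Fin using (Fin)
open import Data.Bool using (Bool)

open import Data.Nat as ℕ using (zero; suc; _≡ᵇ_; z≤n; s≤s)
import Data.Nat.Properties as ℕₚ
open import Data.Integer using (+_; -_; _+_; _-_; _*_)
open import Data.Integer.Properties
  using (+-identityˡ; +-identityʳ; neg-involutive; *-zeroʳ; *-identityʳ; +-0-abelianGroup)
open import Algebra.Properties.AbelianGroup +-0-abelianGroup using () renaming (∙-cancelʳ to +-cancelʳ)
open import Data.Integer.Tactic.RingSolver using (solve-∀)
open import Data.Fin using (zero; suc; toℕ; splitAt; _↑ˡ_; _↑ʳ_; _≟_; fromℕ<; fromℕ)
open import Data.Fin.Properties
  using (splitAt-↑ˡ; splitAt-↑ʳ; join-splitAt; toℕ-fromℕ<; toℕ-fromℕ; toℕ-injective; toℕ≤pred[n]; suc-injective)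
open import Data.Sum using (inj₁; inj₂)
open import Data.Bool using (true; false; if_then_else_; not)
open import Data.Bool.Properties using (T-≡)
open import Data.Unit using (⊤; tt)
open import Data.Empty using (⊥-elim)
open import Relation.Nullary using (yes; no)
open import Relation.Binary.PropositionalEquality
open import Function using (_∘_; Equivalence)

sumℤ-cong : ∀ {m} {f g : Fin m → ℤ} → (∀ i → f i ≡ g i) → sumℤ f ≡ sumℤ g
sumℤ-cong {zero}  eq = refl
sumℤ-cong {suc m} eq = cong₂ _+_ (eq zero) (sumℤ-cong (eq ∘ suc))

sumℤ-zero : ∀ m → sumℤ {m} (λ _ → + 0) ≡ + 0
sumℤ-zero zero    = refl
sumℤ-zero (suc m) = trans (+-identityˡ _) (sumℤ-zero m)

sumℤ-+ : ∀ {m} (f g : Fin m → ℤ) → sumℤ (λ i → f i + g i) ≡ sumℤ f + sumℤ g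
sumℤ-+ {zero}  f g = refl
sumℤ-+ {suc m} f g = begin
    (f zero + g zero) + sumℤ (λ i → f (suc i) + g (suc i))
  ≡⟨ cong (λ s → (f zero + g zero) + s) (sumℤ-+ (f ∘ suc) (g ∘ suc)) ⟩
    (f zero + g zero) + (sumℤ (f ∘ suc) + sumℤ (g ∘ suc))
  ≡⟨ interchange (f zero) (g zero) _ _ ⟩
    (f zero + sumℤ (f ∘ suc)) + (g zero + sumℤ (g ∘ suc)) ∎
  where
  open ≡-Reasoning
  interchange : ∀ a b c d → (a + b) + (c + d) ≡ (a + c) + (b + d)
  interchange = solve-∀

sumℤ-↑ : ∀ k n (f : Fin (k ℕ.+ n) → ℤ) →
         sumℤ f ≡ sumℤ (λ y → f (y ↑ˡ n)) + sumℤ (λ j → f (k ↑ʳ j))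
sumℤ-↑ zero    n f = sym (+-identityˡ _)
sumℤ-↑ (suc k) n f = trans (cong (λ s → f zero + s) (sumℤ-↑ k n (f ∘ suc))) (assoc (f zero) _ _)
  where
  assoc : ∀ a b c → a + (b + c) ≡ (a + b) + c
  assoc = solve-∀

sumℤ-exchange : ∀ {m} (x : Fin m) (h h′ : Fin m → ℤ) → (∀ y → y ≢ x → h y ≡ h′ y) →
                sumℤ h + h′ x ≡ sumℤ h′ + h x
sumℤ-exchange zero h h′ eq =
  trans (cong (λ s → (h zero + s) + h′ zero) (sumℤ-cong (λ i → eq (suc i) λ ())))
        (swap (h zero) (h′ zero) _)
  where
  swap : ∀ a b s → (a + s) + b ≡ (b + s) + a
  swap = solve-∀
sumℤ-exchange (suc x) h h′ eq = begin
    (h zero + sumℤ (h ∘ suc)) + h′ (suc x)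
  ≡⟨ assoc (h zero) _ _ ⟩
    h zero + (sumℤ (h ∘ suc) + h′ (suc x))
  ≡⟨ cong₂ _+_ (eq zero λ ())
               (sumℤ-exchange x (h ∘ suc) (h′ ∘ suc) (λ y y≢x → eq (suc y) (y≢x ∘ suc-injective))) ⟩
    h′ zero + (sumℤ (h′ ∘ suc) + h (suc x))
  ≡⟨ sym (assoc (h′ zero) _ _) ⟩
    (h′ zero + sumℤ (h′ ∘ suc)) + h (suc x) ∎
  where
  open ≡-Reasoning
  assoc : ∀ a b c → (a + b) + c ≡ a + (b + c)
  assoc = solve-∀

δ-≡ : ∀ {N} {i j : Fin N} → i ≡ j → δ i j ≡ + 1
δ-≡ {i = i} {j} i≡j with i ≟ j
... | yes _   = refl
... | no  i≢j = ⊥-elim (i≢j i≡j)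

δ-≢ : ∀ {N} {i j : Fin N} → i ≢ j → δ i j ≡ + 0
δ-≢ {i = i} {j} i≢j with i ≟ j
... | yes i≡j = ⊥-elim (i≢j i≡j)
... | no  _   = refl

reflect-≡ : ∀ {N} (A : Fin N → Fin N → ℤ) i β → reflect A i β i ≡ β i - pairing A i β
reflect-≡ A i β =
  trans (cong (λ d → β i - pairing A i β * d) (δ-≡ refl)) (cong (λ p → β i - p) (*-identityʳ _))

reflect-≢ : ∀ {N} (A : Fin N → Fin N → ℤ) {i j} β → i ≢ j → reflect A i β j ≡ β j
reflect-≢ A {i} {j} β i≢j = begin
  β j - pairing A i β * δ i j  ≡⟨ cong (λ d → β j - pairing A i β * d) (δ-≢ i≢j) ⟩
  β j - pairing A i β * + 0    ≡⟨ cong (λ p → β j - p) (*-zeroʳ (pairing A i β)) ⟩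
  β j - + 0                    ≡⟨ +-identityʳ _ ⟩
  β j                          ∎
  where open ≡-Reasoning

InΦ-cong : ∀ {N} {B : Fin N → Fin N → ℤ} {β β′} → (∀ w → β w ≡ β′ w) → InΦ B β → InΦ B β′
InΦ-cong eq (simple i e)    = simple i (λ j → trans (sym (eq j)) (e j))
InΦ-cong eq (refl-s i γ e)  = refl-s i γ (λ j → trans (sym (eq j)) (e j))

guard : Bool → ℤ → ℤ
guard b c = if b then c else + 0

guard-* : ∀ b c a → guard b c * a ≡ guard b (c * a)
guard-* true  c a = refl
guard-* false c a = refl

guard-zero : ∀ b → guard b (+ 0) ≡ + 0
guard-zero true  = refl
guard-zero false = refl

sumℤ-guard : ∀ {m} b (h : Fin m → ℤ) → sumℤ (λ i → guard b (h i)) ≡ guard b (sumℤ h)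
sumℤ-guard true  h = refl
sumℤ-guard {m} false h = sumℤ-zero m

≡ᵇ-≡ : ∀ {m n} → m ≡ n → (m ≡ᵇ n) ≡ true
≡ᵇ-≡ {m} {n} m≡n = Equivalence.to T-≡ (ℕₚ.≡⇒≡ᵇ m n m≡n)

≡ᵇ-≢ : ∀ {m n} → m ≢ n → (m ≡ᵇ n) ≡ false
≡ᵇ-≢ {zero}  {zero}  m≢n = ⊥-elim (m≢n refl)
≡ᵇ-≢ {zero}  {suc n} m≢n = refl
≡ᵇ-≢ {suc m} {zero}  m≢n = refl
≡ᵇ-≢ {suc m} {suc n} m≢n = ≡ᵇ-≢ (m≢n ∘ cong suc)

previous : ℕ → (ℕ → ℤ) → ℤ
previous zero    G = + 0
previous (suc i) G = G i

next : ℕ → ℕ → (ℕ → ℤ) → ℤ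
next zero    i       G = + 0
next (suc n) zero    G = G 1
next (suc n) (suc i) G = next n i (G ∘ suc)

next-< : ∀ {n i} (G : ℕ → ℤ) → i ℕ.< n → next n i G ≡ G (suc i)
next-< {suc n} {zero}  G _         = refl
next-< {suc n} {suc i} G (s≤s i<n) = next-< (G ∘ suc) i<n

next-last : ∀ n (G : ℕ → ℤ) → next n n G ≡ + 0
next-last zero    G = refl
next-last (suc n) G = next-last n (G ∘ suc)

sumℤ-pathEntry : ∀ n i → i ℕ.≤ n → (G : ℕ → ℤ) →
  sumℤ {suc n} (λ s → pathEntry i (toℕ s) * G (toℕ s)) ≡ + 2 * G i - previous i G - next n i G
sumℤ-pathEntry zero zero z≤n G = rearrange (G 0)
  where
  rearrange : ∀ a → + 2 * a + + 0 ≡ + 2 * a - + 0 - + 0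
  rearrange = solve-∀
sumℤ-pathEntry (suc n) zero z≤n G =
  trans (cong (λ s → + 2 * G 0 + (- + 1 * G 1 + s)) rest≡0) (rearrange (G 0) (G 1))
  where
  rest≡0 : sumℤ {n} (λ s → pathEntry 0 (suc (suc (toℕ s))) * G (suc (suc (toℕ s)))) ≡ + 0
  rest≡0 = sumℤ-zero n
  rearrange : ∀ a b → + 2 * a + (- + 1 * b + + 0) ≡ + 2 * a - + 0 - b
  rearrange = solve-∀
sumℤ-pathEntry (suc n) (suc zero) (s≤s i≤n) G =
  trans (cong (λ s → - + 1 * G 0 + s) (sumℤ-pathEntry n zero i≤n (G ∘ suc))) (rearrange (G 0) (G 1) _)
  where
  rearrange : ∀ a b c → - + 1 * a + (+ 2 * b - + 0 - c) ≡ + 2 * b - a - c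
  rearrange = solve-∀
sumℤ-pathEntry (suc n) (suc (suc i)) (s≤s i≤n) G =
  trans (+-identityˡ _) (sumℤ-pathEntry n (suc i) i≤n (G ∘ suc))

attached-sum : ∀ n b (c a : ℤ) → sumℤ {suc n} (λ t → guard (attached n b t) c * a) ≡ c * a
attached-sum n true c a =
  trans (cong (λ s → c * a + s) (sumℤ-zero n)) (+-identityʳ _)
attached-sum zero    false c a = +-identityʳ _
attached-sum (suc n) false c a = trans (+-identityˡ _) (attached-sum n false c a)

step : ℤ → ℕ → ℤ → ℕ → ℤ
step u zero    a s       = a
step u (suc j) a zero    = u
step u (suc j) a (suc s) = step u j a s

step-< : ∀ u {j} a {s} → s ℕ.< j → step u j a s ≡ u
step-< u a {zero}  (s≤s _)   = refl
step-< u a {suc s} (s≤s s<j) = step-< u a s<j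

step-≥ : ∀ u {j} a {s} → j ℕ.≤ s → step u j a s ≡ a
step-≥ u a z≤n       = refl
step-≥ u a (s≤s j≤s) = step-≥ u a j≤s

step-suc : ∀ u j a {s} → s ≢ j → step u (suc j) a s ≡ step u j a s
step-suc u zero    a {zero}  s≢j = ⊥-elim (s≢j refl)
step-suc u zero    a {suc s} s≢j = refl
step-suc u (suc j) a {zero}  s≢j = refl
step-suc u (suc j) a {suc s} s≢j = step-suc u j a (s≢j ∘ cong suc)

-- With u = -L, the left neighbour of x_i contributes L both at i = 0 (the side L_x) and inside the path.
guard-previous-step : ∀ L {i j} a → i ℕ.≤ j → guard (i ≡ᵇ 0) L - previous i (step (- L) j a) ≡ L
guard-previous-step L {zero}  a _         = +-identityʳ L
guard-previous-step L {suc i} a i<j =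
  trans (cong (λ p → + 0 - p) (step-< (- L) a i<j)) (trans (+-identityˡ _) (neg-involutive L))

guard-attached : ∀ n b t (c : ℤ) →
  guard (attached n b t) c ≡ guard (toℕ t ≡ᵇ 0) (guard b c) + guard (toℕ t ≡ᵇ n) (guard (not b) c)
guard-attached n true  t c =
  sym (trans (cong (λ s → guard (toℕ t ≡ᵇ 0) c + s) (guard-zero (toℕ t ≡ᵇ n))) (+-identityʳ _))
guard-attached n false t c =
  sym (trans (cong (λ s → s + guard (toℕ t ≡ᵇ n) c) (guard-zero (toℕ t ≡ᵇ 0))) (+-identityˡ _))

module Stretch {k : ℕ} (A : Fin k → Fin k → ℤ) (x : Fin k) (side : Fin k → Bool) (n : ℕ) where

  B : Fin (k ℕ.+ n) → Fin (k ℕ.+ n) → ℤ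
  B = stA n A x side

  E : Loc {k} n → Loc n → ℤ
  E = stEntry n A x side

  -- `loc` never produces `off x`; every other location is a vertex of st_n(G).
  IsVertex : Loc {k} n → Set
  IsVertex (off y)  = y ≢ x
  IsVertex (path _) = ⊤

  enc : Loc {k} n → Fin (k ℕ.+ n)
  enc (off y)        = y ↑ˡ n
  enc (path zero)    = x ↑ˡ n
  enc (path (suc j)) = k ↑ʳ j

  enc-loc : ∀ w → enc (loc n x w) ≡ w
  enc-loc w with splitAt k w | join-splitAt k n w
  ... | inj₂ j | eq = eq
  ... | inj₁ y | eq with y ≟ x
  ...   | yes refl = eq
  ...   | no  _    = eq

  loc-IsVertex : ∀ w → IsVertex (loc n x w)
  loc-IsVertex w with splitAt k w
  ... | inj₂ j = tt
  ... | inj₁ y with y ≟ x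
  ...   | yes _   = tt
  ...   | no  y≢x = y≢x

  loc-enc : ∀ {l} → IsVertex l → loc n x (enc l) ≡ l
  loc-enc {off y} y≢x rewrite splitAt-↑ˡ k y n with y ≟ x
  ... | yes y≡x = ⊥-elim (y≢x y≡x)
  ... | no  _   = refl
  loc-enc {path zero} _ rewrite splitAt-↑ˡ k x n with x ≟ x
  ... | yes _   = refl
  ... | no  x≢x = ⊥-elim (x≢x refl)
  loc-enc {path (suc j)} _ rewrite splitAt-↑ʳ k n j = refl

  loc-≢ : ∀ {l w} → enc l ≢ w → loc n x w ≢ l
  loc-≢ {w = w} enc≢w loc≡l = enc≢w (trans (cong enc (sym loc≡l)) (enc-loc w))

  lift : (Loc {k} n → ℤ) → Fin (k ℕ.+ n) → ℤ
  lift V w = V (loc n x w)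

  Root : (Loc {k} n → ℤ) → Set
  Root V = InΦ B (lift V)

  Root-cong : ∀ {V V′} → (∀ l → IsVertex l → V l ≡ V′ l) → Root V → Root V′
  Root-cong eq = InΦ-cong (λ w → eq (loc n x w) (loc-IsVertex w))

  Root-simple : ∀ {l V} → IsVertex l → V l ≡ + 1 → (∀ l′ → IsVertex l′ → l′ ≢ l → V l′ ≡ + 0) → Root V
  Root-simple {l} {V} vl V-l V-≢ = simple (enc l) V≡δ
    where
    V≡δ : ∀ w → lift V w ≡ δ (enc l) w
    V≡δ w with enc l ≟ w
    ... | yes refl  = trans (cong V (loc-enc vl)) V-l
    ... | no  enc≢w = V-≢ _ (loc-IsVertex w) (loc-≢ enc≢w)

  Root-reflect : ∀ {l V V′} P → IsVertex l → pairing B (enc l) (lift V) ≡ P →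
                 V′ l ≡ V l - P → (∀ l′ → IsVertex l′ → l′ ≢ l → V′ l′ ≡ V l′) → Root V → Root V′
  Root-reflect {l} {V} {V′} P vl pairing≡P V′-l V′-≢ root = refl-s (enc l) root V′≡sV
    where
    P′ = pairing B (enc l) (lift V)
    V′≡sV : ∀ w → lift V′ w ≡ reflect B (enc l) (lift V) w
    V′≡sV w with enc l ≟ w
    ... | yes refl = begin
      V′ (loc n x (enc l))                        ≡⟨ cong V′ (loc-enc vl) ⟩
      V′ l                                        ≡⟨ V′-l ⟩
      V l - P                                     ≡⟨ cong₂ _-_ (cong V (sym (loc-enc vl))) (sym pairing≡P) ⟩
      lift V (enc l) - pairing B (enc l) (lift V) ≡⟨ cong (λ p → lift V (enc l) - p) (sym (*-identityʳ _)) ⟩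
      lift V (enc l) - pairing B (enc l) (lift V) * + 1 ∎
      where open ≡-Reasoning
    ... | no  enc≢w = begin
      lift V′ w                                 ≡⟨ V′-≢ _ (loc-IsVertex w) (loc-≢ enc≢w) ⟩
      lift V w                                  ≡⟨ sym (+-identityʳ _) ⟩
      lift V w - + 0                            ≡⟨ cong (λ p → lift V w - p) (sym (*-zeroʳ P′)) ⟩
      lift V w - P′ * + 0                       ∎
      where open ≡-Reasoning

  sumℤ-loc : (F : Loc {k} n → ℤ) →
             sumℤ (F ∘ loc n x) + F (off x) ≡ sumℤ (F ∘ off) + sumℤ (F ∘ path)
  sumℤ-loc F = begin
      sumℤ (F ∘ loc n x) + F (off x)
    ≡⟨ cong (λ s → s + F (off x)) (sumℤ-↑ k n (F ∘ loc n x)) ⟩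
      (sumℤ old + sumℤ (λ j → F (loc n x (k ↑ʳ j)))) + F (off x)
    ≡⟨ cong (λ s → (sumℤ old + s) + F (off x)) (sumℤ-cong (λ j → cong F (loc-enc {path (suc j)} tt))) ⟩
      (sumℤ old + sumℤ new) + F (off x)
    ≡⟨ swap (sumℤ old) _ _ ⟩
      (sumℤ old + F (off x)) + sumℤ new
    ≡⟨ cong (λ s → s + sumℤ new) (sumℤ-exchange x old (F ∘ off) (λ y y≢x → cong F (loc-enc y≢x))) ⟩
      (sumℤ (F ∘ off) + F (loc n x (x ↑ˡ n))) + sumℤ new
    ≡⟨ cong (λ l → (sumℤ (F ∘ off) + F l) + sumℤ new) (loc-enc {path zero} tt) ⟩
      (sumℤ (F ∘ off) + F (path zero)) + sumℤ new
    ≡⟨ assoc (sumℤ (F ∘ off)) (F (path zero)) (sumℤ new) ⟩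
      sumℤ (F ∘ off) + sumℤ (F ∘ path) ∎
    where
    open ≡-Reasoning
    old new : Fin _ → ℤ
    old y = F (loc n x (y ↑ˡ n))
    new j = F (path (suc j))
    swap : ∀ a b c → (a + b) + c ≡ (a + c) + b
    swap = solve-∀
    assoc : ∀ a b c → (a + b) + c ≡ a + (b + c)
    assoc = solve-∀

  pairing-lift : ∀ {l} → IsVertex l → (V : Loc {k} n → ℤ) →
                 pairing B (enc l) (lift V) + E l (off x) * V (off x)
                   ≡ sumℤ (λ y → E l (off y) * V (off y)) + sumℤ (λ t → E l (path t) * V (path t))
  pairing-lift {l} vl V =
    trans (cong (λ s → s + E l (off x) * V (off x))
                (sumℤ-cong (λ w → cong (λ l′ → E l′ (loc n x w) * lift V w) (loc-enc vl))))
          (sumℤ-loc (λ l′ → E l l′ * V l′))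

  extend : (Fin k → ℤ) → Loc {k} n → ℤ
  extend α (off y)  = α y
  extend α (path _) = α x

  StRoot : (Fin k → ℤ) → Set
  StRoot α = Root (extend α)

  StRoot-cong : ∀ {α β} → (∀ j → α j ≡ β j) → StRoot α → StRoot β
  StRoot-cong {α} {β} eq = Root-cong {extend α} {extend β} λ { (off y) _ → eq y ; (path _) _ → eq x }

  -- α_i meets exactly one endpoint of the path, so it sees x exactly once.
  pairing-off : ∀ {i} → i ≢ x → (γ : Fin k → ℤ) →
                pairing B (enc (off i)) (lift (extend γ)) ≡ pairing A i γ
  pairing-off {i} i≢x γ = +-cancelʳ (A i x * γ x) _ _
    (trans (pairing-lift i≢x (extend γ))
           (cong (λ s → pairing A i γ + s) (attached-sum n (side i) (A i x) (γ x))))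

  StRoot-simple-off : ∀ {i} → i ≢ x → StRoot (δ i)
  StRoot-simple-off {i} i≢x = Root-simple {off i} i≢x (δ-≡ refl) vanishes
    where
    vanishes : ∀ l → IsVertex l → l ≢ off i → extend (δ i) l ≡ + 0
    vanishes (off y)  _ y≢i = δ-≢ (λ i≡y → y≢i (cong off (sym i≡y)))
    vanishes (path _) _ _   = δ-≢ i≢x

  StRoot-reflect-off : ∀ {i γ} → i ≢ x → StRoot γ → StRoot (reflect A i γ)
  StRoot-reflect-off {i} {γ} i≢x =
    Root-reflect (pairing A i γ) i≢x (pairing-off i≢x γ) (reflect-≡ A i γ) unchanged
    where
    unchanged : ∀ l → IsVertex l → l ≢ off i → extend (reflect A i γ) l ≡ extend γ l
    unchanged (off y)  _ y≢i = reflect-≢ A γ (λ i≡y → y≢i (cong off (sym i≡y)))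
    unchanged (path _) _ _   = reflect-≢ A γ i≢x

  leftSum rightSum : (Fin k → ℤ) → ℤ
  leftSum  f = sumℤ (λ y → guard (side y) (A x y * f y))
  rightSum f = sumℤ (λ y → guard (not (side y)) (A x y * f y))

  sumℤ-sides : (f : Fin k → ℤ) → sumℤ (λ y → A x y * f y) ≡ leftSum f + rightSum f
  sumℤ-sides f = trans (sumℤ-cong split) (sumℤ-+ (λ y → guard (side y) (A x y * f y))
                                                  (λ y → guard (not (side y)) (A x y * f y)))
    where
    split : ∀ y → A x y * f y ≡ guard (side y) (A x y * f y) + guard (not (side y)) (A x y * f y)
    split y with side y
    ... | true  = sym (+-identityʳ _)
    ... | false = sym (+-identityˡ _)

  pathState : (Fin k → ℤ) → (ℕ → ℤ) → Loc {k} n → ℤ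
  pathState f G (off y)  = f y
  pathState f G (path t) = G (toℕ t)

  pathPairing : (Fin k → ℤ) → (ℕ → ℤ) → ℕ → ℤ
  pathPairing f G i = (guard (i ≡ᵇ 0) (leftSum f) - previous i G)
                    + (guard (i ≡ᵇ n) (rightSum f) - next n i G) + + 2 * G i

  sumℤ-off-path : ∀ t f → sumℤ (λ y → E (path t) (off y) * f y)
                         ≡ guard (toℕ t ≡ᵇ 0) (leftSum f) + guard (toℕ t ≡ᵇ n) (rightSum f)
  sumℤ-off-path t f = begin
      sumℤ (λ y → E (path t) (off y) * f y)
    ≡⟨ sumℤ-cong (λ y → trans (guard-* (attached n (side y) t) (A x y) (f y))
                               (guard-attached n (side y) t (A x y * f y))) ⟩
      sumℤ (λ y → guard (toℕ t ≡ᵇ 0) (L y) + guard (toℕ t ≡ᵇ n) (R y))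
    ≡⟨ sumℤ-+ (λ y → guard (toℕ t ≡ᵇ 0) (L y)) (λ y → guard (toℕ t ≡ᵇ n) (R y)) ⟩
      sumℤ (λ y → guard (toℕ t ≡ᵇ 0) (L y)) + sumℤ (λ y → guard (toℕ t ≡ᵇ n) (R y))
    ≡⟨ cong₂ _+_ (sumℤ-guard (toℕ t ≡ᵇ 0) L) (sumℤ-guard (toℕ t ≡ᵇ n) R) ⟩
      guard (toℕ t ≡ᵇ 0) (leftSum f) + guard (toℕ t ≡ᵇ n) (rightSum f) ∎
    where
    open ≡-Reasoning
    L R : Fin k → ℤ
    L y = guard (side y) (A x y * f y)
    R y = guard (not (side y)) (A x y * f y)

  pairing-path : ∀ {f} G t → f x ≡ + 0 →
                 pairing B (enc (path t)) (lift (pathState f G)) ≡ pathPairing f G (toℕ t)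
  pairing-path {f} G t f-x = begin
      P
    ≡⟨ sym (+-identityʳ P) ⟩
      P + + 0
    ≡⟨ cong (λ v → P + v) (sym x-term≡0) ⟩
      P + E (path t) (off x) * f x
    ≡⟨ pairing-lift {path t} tt (pathState f G) ⟩
      sumℤ (λ y → E (path t) (off y) * f y)
        + sumℤ {suc n} (λ s → pathEntry (toℕ t) (toℕ s) * G (toℕ s))
    ≡⟨ cong₂ _+_ (sumℤ-off-path t f) (sumℤ-pathEntry n (toℕ t) (toℕ≤pred[n] t) G) ⟩
      (l + r) + (+ 2 * G i - previous i G - next n i G)
    ≡⟨ regroup l r (G i) (previous i G) (next n i G) ⟩
      pathPairing f G i ∎
    where
    open ≡-Reasoning
    i = toℕ t
    l = guard (i ≡ᵇ 0) (leftSum f)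
    r = guard (i ≡ᵇ n) (rightSum f)
    regroup : ∀ l r g p q → (l + r) + (+ 2 * g - p - q) ≡ (l - p) + (r - q) + + 2 * g
    regroup = solve-∀
    P = pairing B (enc (path t)) (lift (pathState f G))
    x-term≡0 : E (path t) (off x) * f x ≡ + 0
    x-term≡0 = trans (cong (λ v → E (path t) (off x) * v) f-x) (*-zeroʳ (E (path t) (off x)))

  Root-reflect-path : ∀ {f G G′ i} → f x ≡ + 0 → i ℕ.≤ n →
    G′ i ≡ G i - pathPairing f G i → (∀ s → s ℕ.≤ n → s ≢ i → G′ s ≡ G s) →
    Root (pathState f G) → Root (pathState f G′)
  Root-reflect-path {f} {G} {G′} {i} f-x i≤n G′-i G′-≢ =
    Root-reflect {path t} (pathPairing f G i) tt
      (trans (pairing-path G t f-x) (cong (pathPairing f G) toℕ-t))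
      (subst (λ s → G′ s ≡ G s - pathPairing f G i) (sym toℕ-t) G′-i)
      unchanged
    where
    t : Fin (suc n)
    t = fromℕ< (s≤s i≤n)
    toℕ-t : toℕ t ≡ i
    toℕ-t = toℕ-fromℕ< (s≤s i≤n)
    unchanged : ∀ l → IsVertex l → l ≢ path t → pathState f G′ l ≡ pathState f G l
    unchanged (off y)  _ _   = refl
    unchanged (path s) _ s≢t =
      G′-≢ (toℕ s) (toℕ≤pred[n] s) (λ s≡i → s≢t (cong path (toℕ-injective (trans s≡i (sym toℕ-t)))))

  module Sweep (f : Fin k → ℤ) (f-x : f x ≡ + 0) where

    u : ℤ
    u = - leftSum f

    right-interior : ∀ {i} G → i ℕ.< n → guard (i ≡ᵇ n) (rightSum f) - next n i G ≡ - G (suc i)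
    right-interior {i} G i<n rewrite ≡ᵇ-≢ (ℕₚ.<⇒≢ i<n) | next-< G i<n = +-identityˡ _

    right-last : ∀ G → guard (n ≡ᵇ n) (rightSum f) - next n n G ≡ rightSum f
    right-last G rewrite ≡ᵇ-≡ {n} refl | next-last n G = +-identityʳ _

    pathPairing-up : ∀ {j} a → j ℕ.< n → pathPairing f (step u j a) j ≡ a - u
    pathPairing-up {j} a j<n = begin
        pathPairing f G j
      ≡⟨ cong₂ (λ p q → p + q + + 2 * G j)
               (guard-previous-step (leftSum f) a (ℕₚ.≤-refl {j})) (right-interior G j<n) ⟩
        leftSum f + - G (suc j) + + 2 * G j
      ≡⟨ cong₂ (λ p q → leftSum f + - p + + 2 * q) (step-≥ u a (ℕₚ.n≤1+n j)) (step-≥ u a (ℕₚ.≤-refl {j})) ⟩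
        leftSum f + - a + + 2 * a
      ≡⟨ rearrange (leftSum f) a ⟩
        a - u ∎
      where
      open ≡-Reasoning
      G = step u j a
      rearrange : ∀ l a → l + - a + + 2 * a ≡ a - - l
      rearrange = solve-∀

    pathPairing-down : ∀ {i} b → i ℕ.< n → pathPairing f (step u (suc i) b) i ≡ u - b
    pathPairing-down {i} b i<n = begin
        pathPairing f G i
      ≡⟨ cong₂ (λ p q → p + q + + 2 * G i)
               (guard-previous-step (leftSum f) b (ℕₚ.n≤1+n i)) (right-interior G i<n) ⟩
        leftSum f + - G (suc i) + + 2 * G i
      ≡⟨ cong₂ (λ p q → leftSum f + - p + + 2 * q)
               (step-≥ u b (ℕₚ.≤-refl {suc i})) (step-< u b (ℕₚ.n<1+n i)) ⟩
        leftSum f + - b + + 2 * u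
      ≡⟨ rearrange (leftSum f) b ⟩
        u - b ∎
      where
      open ≡-Reasoning
      G = step u (suc i) b
      rearrange : ∀ l b → l + - b + + 2 * - l ≡ - l - b
      rearrange = solve-∀

    pathPairing-last : ∀ a → pathPairing f (step u n a) n ≡ + 2 * a + leftSum f + rightSum f
    pathPairing-last a = begin
        pathPairing f G n
      ≡⟨ cong₂ (λ p q → p + q + + 2 * G n)
               (guard-previous-step (leftSum f) a (ℕₚ.≤-refl {n})) (right-last G) ⟩
        leftSum f + rightSum f + + 2 * G n
      ≡⟨ cong (λ q → leftSum f + rightSum f + + 2 * q) (step-≥ u a (ℕₚ.≤-refl {n})) ⟩
        leftSum f + rightSum f + + 2 * a
      ≡⟨ rearrange (leftSum f) (rightSum f) a ⟩
        + 2 * a + leftSum f + rightSum f ∎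
      where
      open ≡-Reasoning
      G = step u n a
      rearrange : ∀ l r a → l + r + + 2 * a ≡ + 2 * a + l + r
      rearrange = solve-∀

    move-up : ∀ {j} a → j ℕ.< n → Root (pathState f (step u j a)) → Root (pathState f (step u (suc j) a))
    move-up {j} a j<n = Root-reflect-path f-x (ℕₚ.<⇒≤ j<n) new-value (λ s _ s≢j → step-suc u j a s≢j)
      where
      new-value : step u (suc j) a j ≡ step u j a j - pathPairing f (step u j a) j
      new-value = begin
        step u (suc j) a j  ≡⟨ step-< u a (ℕₚ.n<1+n j) ⟩
        u                   ≡⟨ rearrange u a ⟩
        a - (a - u)         ≡⟨ cong₂ _-_ (sym (step-≥ u a (ℕₚ.≤-refl {j}))) (sym (pathPairing-up a j<n)) ⟩
        step u j a j - pathPairing f (step u j a) j ∎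
        where
        open ≡-Reasoning
        rearrange : ∀ u a → u ≡ a - (a - u)
        rearrange = solve-∀

    move-down : ∀ {i} b → i ℕ.< n → Root (pathState f (step u (suc i) b)) → Root (pathState f (step u i b))
    move-down {i} b i<n = Root-reflect-path f-x (ℕₚ.<⇒≤ i<n) new-value (λ s _ s≢i → sym (step-suc u i b s≢i))
      where
      new-value : step u i b i ≡ step u (suc i) b i - pathPairing f (step u (suc i) b) i
      new-value = begin
        step u i b i        ≡⟨ step-≥ u b (ℕₚ.≤-refl {i}) ⟩
        b                   ≡⟨ rearrange u b ⟩
        u - (u - b)         ≡⟨ cong₂ _-_ (sym (step-< u b (ℕₚ.n<1+n i))) (sym (pathPairing-down b i<n)) ⟩
        step u (suc i) b i - pathPairing f (step u (suc i) b) i ∎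
        where
        open ≡-Reasoning
        rearrange : ∀ u b → b ≡ u - (u - b)
        rearrange = solve-∀

    move-last : ∀ a → Root (pathState f (step u n a)) →
                Root (pathState f (step u n (a - (+ 2 * a + leftSum f + rightSum f))))
    move-last a = Root-reflect-path f-x ℕₚ.≤-refl new-value unchanged
      where
      c = + 2 * a + leftSum f + rightSum f
      new-value : step u n (a - c) n ≡ step u n a n - pathPairing f (step u n a) n
      new-value = trans (step-≥ u (a - c) (ℕₚ.≤-refl {n}))
                        (sym (cong₂ _-_ (step-≥ u a (ℕₚ.≤-refl {n})) (pathPairing-last a)))
      unchanged : ∀ s → s ℕ.≤ n → s ≢ n → step u n (a - c) s ≡ step u n a s
      unchanged s s≤n s≢n = trans (step-< u (a - c) s<n) (sym (step-< u a s<n))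
        where s<n = ℕₚ.≤∧≢⇒< s≤n s≢n

    sweep-up : ∀ {j} a → j ℕ.≤ n → Root (pathState f (step u 0 a)) → Root (pathState f (step u j a))
    sweep-up {zero}  a _   root = root
    sweep-up {suc j} a j<n root = move-up a j<n (sweep-up a (ℕₚ.<⇒≤ j<n) root)

    sweep-down : ∀ {j} b → j ℕ.≤ n → Root (pathState f (step u j b)) → Root (pathState f (step u 0 b))
    sweep-down {zero}  b _   root = root
    sweep-down {suc j} b j<n root = sweep-down b (ℕₚ.<⇒≤ j<n) (move-down b j<n root)

  offPart : (Fin k → ℤ) → Fin k → ℤ
  offPart γ y with y ≟ x
  ... | yes _ = + 0
  ... | no  _ = γ y

  offPart-x : ∀ γ → offPart γ x ≡ + 0
  offPart-x γ with x ≟ x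
  ... | yes _   = refl
  ... | no  x≢x = ⊥-elim (x≢x refl)

  offPart-≢ : ∀ γ {y} → y ≢ x → offPart γ y ≡ γ y
  offPart-≢ γ {y} y≢x with y ≟ x
  ... | yes y≡x = ⊥-elim (y≢x y≡x)
  ... | no  _   = refl

  pairing-x-sides : A x x ≡ + 2 → ∀ γ →
                    pairing A x γ ≡ + 2 * γ x + leftSum (offPart γ) + rightSum (offPart γ)
  pairing-x-sides Axx≡2 γ = begin
      pairing A x γ
    ≡⟨ sym (+-identityʳ _) ⟩
      pairing A x γ + + 0
    ≡⟨ cong (λ v → pairing A x γ + v)
            (sym (trans (cong (λ v → A x x * v) (offPart-x γ)) (*-zeroʳ (A x x)))) ⟩
      pairing A x γ + A x x * offPart γ x
    ≡⟨ sym (sumℤ-exchange x (λ y → A x y * offPart γ y) (λ y → A x y * γ y)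
                              (λ y y≢x → cong (λ v → A x y * v) (offPart-≢ γ y≢x))) ⟩
      sumℤ (λ y → A x y * offPart γ y) + A x x * γ x
    ≡⟨ cong₂ (λ s a → s + a * γ x) (sumℤ-sides (offPart γ)) Axx≡2 ⟩
      leftSum (offPart γ) + rightSum (offPart γ) + + 2 * γ x
    ≡⟨ rearrange (leftSum (offPart γ)) (rightSum (offPart γ)) (γ x) ⟩
      + 2 * γ x + leftSum (offPart γ) + rightSum (offPart γ) ∎
    where
    open ≡-Reasoning
    rearrange : ∀ l r a → l + r + + 2 * a ≡ + 2 * a + l + r
    rearrange = solve-∀

  StRoot-reflect-x : ∀ {γ} → A x x ≡ + 2 → StRoot γ → StRoot (reflect A x γ)
  StRoot-reflect-x {γ} Axx≡2 root =
    Root-cong final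
      (sweep-down a′ ℕₚ.≤-refl (move-last a (sweep-up a ℕₚ.≤-refl (Root-cong initial root))))
    where
    open Sweep (offPart γ) (offPart-x γ)
    a = γ x
    a′ = a - (+ 2 * a + leftSum (offPart γ) + rightSum (offPart γ))
    initial : ∀ l → IsVertex l → extend γ l ≡ pathState (offPart γ) (step u 0 a) l
    initial (off y)  y≢x = sym (offPart-≢ γ y≢x)
    initial (path _) _   = refl
    final : ∀ l → IsVertex l → pathState (offPart γ) (step u 0 a′) l ≡ extend (reflect A x γ) l
    final (off y)  y≢x = trans (offPart-≢ γ y≢x) (sym (reflect-≢ A γ (y≢x ∘ sym)))
    final (path _) _   =
      trans (cong (λ c → a - c) (sym (pairing-x-sides Axx≡2 γ))) (sym (reflect-≡ A x γ))

  StRoot-simple-x : StRoot (δ x)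
  StRoot-simple-x = Root-cong final (sweep-down (+ 1) ℕₚ.≤-refl simple-at-end)
    where
    open Sweep (λ _ → + 0) refl
    u≡0 : u ≡ + 0
    u≡0 = cong -_ (trans (sumℤ-cong λ y → trans (cong (guard (side y)) (*-zeroʳ (A x y)))
                                                 (guard-zero (side y)))
                         (sumℤ-zero k))
    vanishes : ∀ l → IsVertex l → l ≢ path (fromℕ n) → pathState (λ _ → + 0) (step u n (+ 1)) l ≡ + 0
    vanishes (off y)  _ _   = refl
    vanishes (path s) _ s≢n = trans (step-< u (+ 1) s<n) u≡0
      where
      s<n = ℕₚ.≤∧≢⇒< (toℕ≤pred[n] s)
                     (λ s≡n → s≢n (cong path (toℕ-injective (trans s≡n (sym (toℕ-fromℕ n))))))
    simple-at-end : Root (pathState (λ _ → + 0) (step u n (+ 1)))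
    simple-at-end = Root-simple {path (fromℕ n)} tt
      (trans (cong (step u n (+ 1)) (toℕ-fromℕ n)) (step-≥ u (+ 1) (ℕₚ.≤-refl {n}))) vanishes
    final : ∀ l → IsVertex l → pathState (λ _ → + 0) (step u 0 (+ 1)) l ≡ extend (δ x) l
    final (off y)  y≢x = sym (δ-≢ (y≢x ∘ sym))
    final (path _) _   = sym (δ-≡ refl)

  StRoot-InΦ : A x x ≡ + 2 → ∀ {α} → InΦ A α → StRoot α
  StRoot-InΦ Axx≡2 (simple i α≡δ) with i ≟ x
  ... | yes refl = StRoot-cong (sym ∘ α≡δ) StRoot-simple-x
  ... | no  i≢x  = StRoot-cong (sym ∘ α≡δ) (StRoot-simple-off i≢x)
  StRoot-InΦ Axx≡2 (refl-s i root α≡sγ) with i ≟ x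
  ... | yes refl = StRoot-cong (sym ∘ α≡sγ) (StRoot-reflect-x Axx≡2 (StRoot-InΦ Axx≡2 root))
  ... | no  i≢x  = StRoot-cong (sym ∘ α≡sγ) (StRoot-reflect-off i≢x (StRoot-InΦ Axx≡2 root))

  lift-extend : ∀ α w → lift (extend α) w ≡ stRoot n x α w
  lift-extend α w with loc n x w
  ... | off y  = refl
  ... | path _ = refl

proposition2p6 : (k : ℕ) (m : Fin k → Fin k → CoxExp) (A : Fin k → Fin k → ℤ) →
    IsCoxeterMatrix m → IsCrystallographic m A →
    (x : Fin k) (side : Fin k → Bool) →
    (α : Fin k → ℤ) → InΦ A α →
    (n : ℕ) → InΦ (stA n A x side) (stRoot n x α)
proposition2p6 k m A _ cartan x side α α∈Φ n =
  InΦ-cong (lift-extend α) (StRoot-InΦ (IsCrystallographic.diag2 cartan x) α∈Φ)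
  where open Stretch A x side n
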